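{- Let $d\ge 3$. Suppose that every strongly connected finite digraph with minimum out-degree at least $d$ has the property that every pair of distinct vertices in it is separable by a friendly partition. Then every finite digraph with minimum out-degree at least $d$ has this property.
   Context: Digraphs have no loops and no parallel arcs in the same direction. A friendly partition of a digraph $G=(V,E)$ is a partition $\{V_1,V_2\}$ of $V$ into two nonempty sets such that every vertex has at least one out-neighbor in its own part; it separates $u,v$ if they lie in different parts. A digraph is strongly connected if there is a directed path from every vertex to every other vertex. -}

module Defs where

open import Data.Nat using (ℕ; _≤_)
open import Data.Fin using (Fin)
open import Data.Bool using (Bool; true; false)
open import Data.List using (List; filter; length)
open import Data.List using () renaming (allFin to allFinL)
open import Data.Product using (Σ; ∃; ∃-syntax; _×_; _,_)
open import Relation.Binary.PropositionalEquality using (_≡_; _≢_)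
open import Relation.Nullary using (¬_)
open import Data.Bool.Properties using (T?)
open import Data.Bool using (T)

-- A finite digraph on vertex set Fin n: arcs given by a Boolean adjacency
-- relation (so no parallel arcs in the same direction), with no loops.
record Digraph (n : ℕ) : Set where
  field
    adj   : Fin n → Fin n → Bool
    loopless : ∀ v → adj v v ≡ false
open Digraph public

outDeg : ∀ {n} → Digraph n → Fin n → ℕ
outDeg G v = length (filter (λ w → T? (adj G v w)) (allFinL _))

MinOutDegAtLeast : ∀ {n} → ℕ → Digraph n → Set
MinOutDegAtLeast d G = ∀ v → d ≤ outDeg G v

data Path {n : ℕ} (G : Digraph n) : Fin n → Fin n → Set where
  here : ∀ {u} → Path G u u
  step : ∀ {u w v} → adj G u w ≡ true → Path G w v → Path G u v

StronglyConnected : ∀ {n} → Digraph n → Set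
StronglyConnected G = ∀ u v → Path G u v

-- a partition {V₁,V₂} encoded by side : Fin n → Bool (V₁ = side⁻¹ true)
FriendlyPartition : ∀ {n} → Digraph n → (Fin n → Bool) → Set
FriendlyPartition G side =
    (∃[ a ] side a ≡ true)
  × (∃[ b ] side b ≡ false)
  × (∀ v → ∃[ w ] (adj G v w ≡ true × side w ≡ side v))

Separates : ∀ {n} → (Fin n → Bool) → Fin n → Fin n → Set
Separates side u v = side u ≢ side v

AllPairsSeparable : ∀ {n} → Digraph n → Set
AllPairsSeparable G = ∀ u v → u ≢ v →
  ∃[ side ] (FriendlyPartition G side × Separates side u v)

-- Induct on |S| for induced subgraphs G[S] with minimum out-degree ≥ d.
-- Given u ≠ v in S, let Reach be the set of vertices reachable from {u, v} and
-- Escape ⊆ Reach the set of those from which neither u nor v is reachable.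
-- Escape is closed under out-arcs, so G[Escape] still has minimum out-degree ≥ d,
-- and it misses u: by induction any two of its vertices are separable. Adding
-- arcs from {u, v} ∪ Escape into {u, v} makes G[Reach] strongly connected, so the
-- hypothesis yields a friendly partition Q of it separating u and v. Following
-- Q-friends from u and from v gives two walks on different Q-sides that use
-- genuine arcs until they enter Escape, which each does at most once; a friendly
-- partition of G[Escape] separating the two entry points then completes them to
-- disjoint sets D_u ∋ u and D_v ∋ v in which every vertex has an out-neighbour.
-- Finally, any two such sets extend to a friendly partition of G[S]: put on u's
-- side every vertex that can reach D_u without passing through D_v.

module Submission where

open import Defs
open import Data.Nat using (ℕ; zero; suc; _≤_; z≤n; s≤s)
open import Data.Nat.Properties using (≤-trans; ≤-reflexive; ≤-pred; m≤n⇒m≤1+n; <-irrefl)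
open import Data.Fin using (Fin; zero; suc)
open import Data.Fin.Properties using (_≟_)
open import Data.Bool using (Bool; true; false; _∧_; _∨_; not)
open import Data.Bool.Properties using (T?; ∧-zeroʳ) renaming (_≟_ to _≟B_)
open import Data.List using (filter; length; tabulate)
open import Data.Maybe using (Maybe; just; nothing; maybe′)
open import Data.Maybe.Properties using (just-injective)
import Data.Maybe as Maybe
open import Data.Product using (∃-syntax; _×_; _,_; proj₁; proj₂)
open import Data.Sum using (_⊎_; inj₁; inj₂)
open import Data.Empty using (⊥; ⊥-elim)
open import Relation.Binary.PropositionalEquality
open import Relation.Nullary using (Dec; yes; no; does)
open import Relation.Nullary.Decidable using (dec-true; dec-false)

true≢false : ∀ {a} → a ≡ true → a ≡ false → ⊥
true≢false refl ()

true-or-false : ∀ a → a ≡ true ⊎ a ≡ false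
true-or-false true = inj₁ refl
true-or-false false = inj₂ refl

∧-elimˡ : ∀ {a b} → a ∧ b ≡ true → a ≡ true
∧-elimˡ {true} _ = refl

∧-elimʳ : ∀ {a b} → a ∧ b ≡ true → b ≡ true
∧-elimʳ {true} p = p

∧-intro : ∀ {a b} → a ≡ true → b ≡ true → a ∧ b ≡ true
∧-intro refl refl = refl

∨-elim : ∀ {a b} → a ∨ b ≡ true → a ≡ true ⊎ b ≡ true
∨-elim {true} _ = inj₁ refl
∨-elim {false} p = inj₂ p

∨-introˡ : ∀ {a b} → a ≡ true → a ∨ b ≡ true
∨-introˡ refl = refl

∨-introʳ : ∀ {a b} → b ≡ true → a ∨ b ≡ true
∨-introʳ {true} _ = refl
∨-introʳ {false} p = p

not-elim : ∀ {a} → not a ≡ true → a ≡ false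
not-elim {false} _ = refl

not-intro : ∀ {a} → a ≡ false → not a ≡ true
not-intro refl = refl

does-sound : ∀ {p} {P : Set p} (P? : Dec P) → does P? ≡ true → P
does-sound (yes p) _ = p

VSet : ℕ → Set
VSet n = Fin n → Bool

Rel : ℕ → Set
Rel n = Fin n → Fin n → Bool

module _ {n : ℕ} where

  infix 4 _∈_ _∉_
  infixr 7 _∩_
  infixr 6 _∪_ _∖_

  _∈_ _∉_ : Fin n → VSet n → Set
  x ∈ S = S x ≡ true
  x ∉ S = S x ≡ false

  Arc : Rel n → Fin n → Fin n → Set
  Arc A x y = A x y ≡ true

  ∅ : VSet n
  ∅ _ = false

  _∩_ _∪_ _∖_ : VSet n → VSet n → VSet n
  (S ∩ T) x = S x ∧ T x
  (S ∪ T) x = S x ∨ T x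
  (S ∖ T) x = S x ∧ not (T x)

  _ᵀ : Rel n → Rel n
  (A ᵀ) x y = A y x

  _≟ᵇ_ : Fin n → Fin n → Bool
  x ≟ᵇ y = does (x ≟ y)

  ⁅_⁆ : Fin n → VSet n
  ⁅ x ⁆ y = y ≟ᵇ x

  ≟ᵇ-sound : ∀ {x y} → x ≟ᵇ y ≡ true → x ≡ y
  ≟ᵇ-sound {x} {y} = does-sound (x ≟ y)

  ≟ᵇ-refl : ∀ x → x ≟ᵇ x ≡ true
  ≟ᵇ-refl x = dec-true (x ≟ x) refl

  ≟ᵇ-≢ : ∀ {x y} → x ≢ y → x ≟ᵇ y ≡ false
  ≟ᵇ-≢ {x} {y} = dec-false (x ≟ y)

anyᵇ : ∀ {n} → VSet n → Bool
anyᵇ {zero} S = false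
anyᵇ {suc n} S = S zero ∨ anyᵇ (λ i → S (suc i))

anyᵇ-intro : ∀ {n} (S : VSet n) x → x ∈ S → anyᵇ S ≡ true
anyᵇ-intro S zero p = ∨-introˡ p
anyᵇ-intro S (suc x) p = ∨-introʳ {S zero} (anyᵇ-intro (λ i → S (suc i)) x p)

anyᵇ-elim : ∀ {n} (S : VSet n) → anyᵇ S ≡ true → ∃[ x ] x ∈ S
anyᵇ-elim {suc n} S p with ∨-elim {S zero} p
... | inj₁ q = zero , q
... | inj₂ q with anyᵇ-elim (λ i → S (suc i)) q
... | x , r = suc x , r

anyᵇ-false : ∀ {n} (S : VSet n) → anyᵇ S ≡ false → ∀ x → x ∉ S
anyᵇ-false S none x with true-or-false (S x)
... | inj₁ x∈S = ⊥-elim (true≢false (anyᵇ-intro S x x∈S) none)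
... | inj₂ x∉S = x∉S

count-cons : Bool → ℕ → ℕ
count-cons true k = suc k
count-cons false k = k

count : ∀ {n} → VSet n → ℕ
count {zero} S = 0
count {suc n} S = count-cons (S zero) (count (λ i → S (suc i)))

count-mono : ∀ {n} (S T : VSet n) → (∀ x → x ∈ S → x ∈ T) → count S ≤ count T
count-mono {zero} S T S⊆T = z≤n
count-mono {suc n} S T S⊆T with S zero in s0 | T zero in t0
... | true | true = s≤s (count-mono _ _ (λ x → S⊆T (suc x)))
... | true | false = ⊥-elim (true≢false (S⊆T zero s0) t0)
... | false | true = m≤n⇒m≤1+n (count-mono _ _ (λ x → S⊆T (suc x)))
... | false | false = count-mono _ _ (λ x → S⊆T (suc x))

count-mono-strict : ∀ {n} (S T : VSet n) → (∀ x → x ∈ S → x ∈ T) →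
  ∀ y → y ∉ S → y ∈ T → suc (count S) ≤ count T
count-mono-strict {suc n} S T S⊆T zero y∉S y∈T rewrite y∉S | y∈T =
  s≤s (count-mono _ _ (λ x → S⊆T (suc x)))
count-mono-strict {suc n} S T S⊆T (suc y) y∉S y∈T with S zero in s0 | T zero in t0
... | true | true = s≤s (count-mono-strict _ _ (λ x → S⊆T (suc x)) y y∉S y∈T)
... | true | false = ⊥-elim (true≢false (S⊆T zero s0) t0)
... | false | true = m≤n⇒m≤1+n (count-mono-strict _ _ (λ x → S⊆T (suc x)) y y∉S y∈T)
... | false | false = count-mono-strict _ _ (λ x → S⊆T (suc x)) y y∉S y∈T

count≤n : ∀ {n} (S : VSet n) → count S ≤ n
count≤n {zero} S = z≤n
count≤n {suc n} S with S zero
... | true = s≤s (count≤n _)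
... | false = m≤n⇒m≤1+n (count≤n _)

count-nonempty : ∀ {n} (S : VSet n) → 1 ≤ count S → ∃[ x ] x ∈ S
count-nonempty S 1≤∣S∣ = anyᵇ-elim S (nonempty S 1≤∣S∣)
  where
  nonempty : ∀ {n} (S : VSet n) → 1 ≤ count S → anyᵇ S ≡ true
  nonempty {suc n} S 1≤∣S∣ with S zero
  ... | true = refl
  ... | false = nonempty (λ i → S (suc i)) 1≤∣S∣

length-filter-tabulate : ∀ {n m} (g : Fin n → Fin m) (S : VSet m) →
  length (filter (λ x → T? (S x)) (tabulate g)) ≡ count (λ i → S (g i))
length-filter-tabulate {zero} g S = refl
length-filter-tabulate {suc n} g S with S (g zero)
... | true = cong suc (length-filter-tabulate (λ i → g (suc i)) S)
... | false = length-filter-tabulate (λ i → g (suc i)) S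

-- Walks and reachability

module _ {n : ℕ} where

  infixr 5 _∷_ _++_
  infixl 5 _∷ʳ_

  data Walk (E : Rel n) : Fin n → Fin n → Set where
    [] : ∀ {x} → Walk E x x
    _∷_ : ∀ {x y z} → Arc E x y → Walk E y z → Walk E x z

  _++_ : ∀ {E x y z} → Walk E x y → Walk E y z → Walk E x z
  [] ++ q = q
  (e ∷ p) ++ q = e ∷ (p ++ q)

  _∷ʳ_ : ∀ {E x y z} → Walk E x y → Arc E y z → Walk E x z
  p ∷ʳ e = p ++ e ∷ []

  reverse : ∀ {E x y} → Walk (E ᵀ) x y → Walk E y x
  reverse [] = []
  reverse (e ∷ p) = reverse p ∷ʳ e

  record Closure (E : Rel n) (X : VSet n) : Set where
    field
      set : VSet n
      seed⊆ : ∀ x → x ∈ X → x ∈ set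
      closed : ∀ x y → x ∈ set → Arc E x y → y ∈ set
      reached : ∀ y → y ∈ set → ∃[ x ] (x ∈ X × Walk E x y)

    walk-closed : ∀ {x y} → x ∈ set → Walk E x y → y ∈ set
    walk-closed x∈ [] = x∈
    walk-closed x∈ (e ∷ p) = walk-closed (closed _ _ x∈ e) p

    reachable : ∀ {x y} → x ∈ X → Walk E x y → y ∈ set
    reachable x∈X = walk-closed (seed⊆ _ x∈X)

module _ {n : ℕ} (E : Rel n) (X : VSet n) where
  private
    expand : VSet n → VSet n
    expand R y = R y ∨ anyᵇ (λ x → R x ∧ E x y)

    iterate : ℕ → VSet n
    iterate zero = X
    iterate (suc k) = expand (iterate k)

    iterate-inflationary : ∀ k y → y ∈ iterate k → y ∈ iterate (suc k)
    iterate-inflationary k y = ∨-introˡ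

    seed⊆iterate : ∀ k y → y ∈ X → y ∈ iterate k
    seed⊆iterate zero y y∈X = y∈X
    seed⊆iterate (suc k) y y∈X = iterate-inflationary k y (seed⊆iterate k y y∈X)

    iterate-reached : ∀ k y → y ∈ iterate k → ∃[ x ] (x ∈ X × Walk E x y)
    iterate-reached zero y y∈X = y , y∈X , []
    iterate-reached (suc k) y y∈ with ∨-elim {iterate k y} y∈
    ... | inj₁ y∈R = iterate-reached k y y∈R
    ... | inj₂ new with anyᵇ-elim (λ z → iterate k z ∧ E z y) new
    ... | z , z∈R∧zy with iterate-reached k z (∧-elimˡ z∈R∧zy)
    ... | x , x∈X , p = x , x∈X , p ∷ʳ ∧-elimʳ {iterate k z} z∈R∧zy

    Stable : ℕ → Set
    Stable k = ∀ y → y ∈ iterate (suc k) → y ∈ iterate k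

    stable-or-growing : ∀ k → (∃[ j ] Stable j) ⊎ k ≤ count (iterate k)
    stable-or-growing zero = inj₂ z≤n
    stable-or-growing (suc k) with stable-or-growing k
    ... | inj₁ stable = inj₁ stable
    ... | inj₂ k≤∣Rₖ∣ with anyᵇ (iterate (suc k) ∖ iterate k) in new
    ... | false = inj₁ (k , λ y y∈ → no-new y y∈ (true-or-false (iterate k y)))
      where
      no-new : ∀ y → y ∈ iterate (suc k) → y ∈ iterate k ⊎ y ∉ iterate k → y ∈ iterate k
      no-new y _ (inj₁ y∈) = y∈
      no-new y y∈ (inj₂ y∉) = ⊥-elim (true≢false (∧-intro y∈ (not-intro y∉))
                                                  (anyᵇ-false (iterate (suc k) ∖ iterate k) new y))
    ... | true with anyᵇ-elim (iterate (suc k) ∖ iterate k) new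
    ... | y , y∈ = inj₂ (≤-trans (s≤s k≤∣Rₖ∣)
        (count-mono-strict (iterate k) (iterate (suc k)) (iterate-inflationary k)
                           y (not-elim (∧-elimʳ {iterate (suc k) y} y∈)) (∧-elimˡ y∈)))

    stable : ∃[ j ] Stable j
    stable with stable-or-growing (suc n)
    ... | inj₁ s = s
    ... | inj₂ n<∣R∣ = ⊥-elim (<-irrefl refl (≤-trans n<∣R∣ (count≤n _)))

  closure : Closure E X
  closure = record
    { set = iterate j
    ; seed⊆ = seed⊆iterate j
    ; closed = λ x y x∈ e → stable-j y (∨-introʳ {iterate j y}
                 (anyᵇ-intro (λ z → iterate j z ∧ E z y) x (∧-intro x∈ e)))
    ; reached = iterate-reached j
    }
    where
    j = proj₁ stable
    stable-j = proj₂ stable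

-- Induced subgraphs

module _ {n : ℕ} where

  Loopless : Rel n → Set
  Loopless A = ∀ x → A x x ≡ false

  _↾_ : Rel n → VSet n → Rel n
  (A ↾ S) x y = A x y ∧ S y

  MinOutDegOn : ℕ → Rel n → VSet n → Set
  MinOutDegOn d A S = ∀ x → x ∈ S → d ≤ count (A x ∩ S)

  StronglyConnectedOn : Rel n → VSet n → Set
  StronglyConnectedOn A S = ∀ x y → x ∈ S → y ∈ S → Walk (A ↾ S) x y

  FriendlyOn : Rel n → VSet n → VSet n → Set
  FriendlyOn A S side = ∀ x → x ∈ S → ∃[ y ] (y ∈ S × Arc A x y × side y ≡ side x)

  SeparableOn : Rel n → VSet n → Set
  SeparableOn A S = ∀ u v → u ∈ S → v ∈ S → u ≢ v →
    ∃[ side ] (FriendlyOn A S side × side u ≢ side v)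

↾-walk-∈ : ∀ {n} {A : Rel n} {S : VSet n} {x y} → Walk (A ↾ S) x y → x ∈ S → y ∈ S
↾-walk-∈ [] x∈S = x∈S
↾-walk-∈ {A = A} {x = x} (e ∷ p) _ = ↾-walk-∈ p (∧-elimʳ {A x _} e)

embed-cons : ∀ {n k} (b : Bool) → (Fin k → Fin n) → Fin (count-cons b k) → Fin (suc n)
embed-cons true e zero = zero
embed-cons true e (suc i) = suc (e i)
embed-cons false e i = suc (e i)

embed : ∀ {n} (S : VSet n) → Fin (count S) → Fin n
embed {suc n} S = embed-cons (S zero) (embed (λ i → S (suc i)))

index-cons : ∀ {n k} (b : Bool) → (Fin n → Maybe (Fin k)) → Fin (suc n) → Maybe (Fin (count-cons b k))
index-cons true g zero = just zero
index-cons true g (suc x) = Maybe.map suc (g x)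
index-cons false g zero = nothing
index-cons false g (suc x) = g x

index : ∀ {n} (S : VSet n) → Fin n → Maybe (Fin (count S))
index {suc n} S = index-cons (S zero) (index (λ i → S (suc i)))

embed-∈ : ∀ {n} (S : VSet n) i → embed S i ∈ S
embed-∈ {suc n} S = go (S zero) refl
  where
  go : ∀ b → S zero ≡ b → ∀ i → embed-cons b (embed (λ j → S (suc j))) i ∈ S
  go true s0 zero = s0
  go true _ (suc i) = embed-∈ (λ j → S (suc j)) i
  go false _ i = embed-∈ (λ j → S (suc j)) i

index-embed : ∀ {n} (S : VSet n) i → index S (embed S i) ≡ just i
index-embed {suc n} S = go (S zero)
  where
  go : ∀ b i → index-cons b (index (λ j → S (suc j))) (embed-cons b (embed (λ j → S (suc j))) i) ≡ just i
  go true zero = refl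
  go true (suc i) rewrite index-embed (λ j → S (suc j)) i = refl
  go false i = index-embed (λ j → S (suc j)) i

embed-surjective : ∀ {n} (S : VSet n) x → x ∈ S → ∃[ i ] embed S i ≡ x
embed-surjective {suc n} S = go (S zero) refl
  where
  go : ∀ b → S zero ≡ b → ∀ x → x ∈ S → ∃[ i ] embed-cons b (embed (λ j → S (suc j))) i ≡ x
  go true _ zero _ = zero , refl
  go true _ (suc x) x∈S with embed-surjective (λ j → S (suc j)) x x∈S
  ... | i , refl = suc i , refl
  go false s0 zero x∈S = ⊥-elim (true≢false x∈S s0)
  go false _ (suc x) x∈S with embed-surjective (λ j → S (suc j)) x x∈S
  ... | i , refl = i , refl

embed-injective : ∀ {n} (S : VSet n) {i j} → embed S i ≡ embed S j → i ≡ j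
embed-injective S {i} {j} eq = just-injective (begin
  just i              ≡⟨ index-embed S i ⟨
  index S (embed S i) ≡⟨ cong (index S) eq ⟩
  index S (embed S j) ≡⟨ index-embed S j ⟩
  just j              ∎)
  where open ≡-Reasoning

count-∩ : ∀ {n} (S T : VSet n) → count (T ∩ S) ≡ count (λ i → T (embed S i))
count-∩ {zero} S T = refl
count-∩ {suc n} S T = go (S zero) refl
  where
  go : ∀ b → S zero ≡ b → count (T ∩ S) ≡ count (λ i → T (embed-cons b (embed (λ j → S (suc j))) i))
  go true s0 rewrite s0 with T zero
  ... | true = cong suc (count-∩ (λ j → S (suc j)) (λ j → T (suc j)))
  ... | false = count-∩ (λ j → S (suc j)) (λ j → T (suc j))
  go false s0 rewrite s0 with T zero
  ... | true = count-∩ (λ j → S (suc j)) (λ j → T (suc j))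
  ... | false = count-∩ (λ j → S (suc j)) (λ j → T (suc j))

module Induced {n} (A : Rel n) (A-loopless : Loopless A) (S : VSet n) where

  digraph : Digraph (count S)
  digraph = record
    { adj = λ i j → A (embed S i) (embed S j)
    ; loopless = λ i → A-loopless (embed S i) }

  minOutDeg : ∀ {d} → MinOutDegOn d A S → MinOutDegAtLeast d digraph
  minOutDeg deg i = ≤-trans (deg (embed S i) (embed-∈ S i)) (≤-reflexive (begin
    count (A (embed S i) ∩ S)            ≡⟨ count-∩ S (A (embed S i)) ⟩
    count (λ j → A (embed S i) (embed S j)) ≡⟨ length-filter-tabulate (λ j → j) (adj digraph i) ⟨
    outDeg digraph i                      ∎))
    where open ≡-Reasoning

  path : ∀ {x y} → Walk (A ↾ S) x y → ∀ i j → embed S i ≡ x → embed S j ≡ y → Path digraph i j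
  path [] i j eq refl = subst (Path digraph i) (embed-injective S eq) here
  path (_∷_ {y = z} e p) i j refl q with embed-surjective S z (∧-elimʳ {A _ z} e)
  ... | k , refl = step (∧-elimˡ e) (path p k j refl q)

  stronglyConnected : StronglyConnectedOn A S → StronglyConnected digraph
  stronglyConnected sc i j = path (sc (embed S i) (embed S j) (embed-∈ S i) (embed-∈ S j)) i j refl refl

  lift-side : (Fin (count S) → Bool) → VSet n
  lift-side side x = maybe′ side false (index S x)

  lift-side-embed : ∀ side i → lift-side side (embed S i) ≡ side i
  lift-side-embed side i rewrite index-embed S i = refl

  separable : AllPairsSeparable digraph → SeparableOn A S
  separable sep u v u∈S v∈S u≢v with embed-surjective S u u∈S | embed-surjective S v v∈S
  ... | i , refl | j , refl with sep i j (λ i≡j → u≢v (cong (embed S) i≡j))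
  ... | side , (_ , _ , friendly) , i≢j = lift-side side , friendlyOn , separates
    where
    friendlyOn : FriendlyOn A S (lift-side side)
    friendlyOn x x∈S with embed-surjective S x x∈S
    ... | k , refl with friendly k
    ... | l , kl , l~k = embed S l , embed-∈ S l , kl ,
      trans (lift-side-embed side l) (trans l~k (sym (lift-side-embed side k)))
    separates : lift-side side (embed S i) ≢ lift-side side (embed S j)
    separates eq = i≢j (trans (sym (lift-side-embed side i)) (trans eq (lift-side-embed side j)))

StronglyConnectedSeparable : ℕ → Set
StronglyConnectedSeparable d =
  ∀ (n : ℕ) (G : Digraph n) → StronglyConnected G → MinOutDegAtLeast d G → AllPairsSeparable G

separableOn-stronglyConnected : ∀ {d} → StronglyConnectedSeparable d →
  ∀ {n} {A : Rel n} {S : VSet n} → Loopless A → MinOutDegOn d A S → StronglyConnectedOn A S → SeparableOn A S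
separableOn-stronglyConnected hyp {A = A} {S} A-loopless deg sc =
  separable (hyp _ digraph (stronglyConnected sc) (minOutDeg deg))
  where open Induced A A-loopless S

-- Friendly partitions from sink-free sets

module _ {n : ℕ} where

  SinkFreeIn : Rel n → VSet n → VSet n → Set
  SinkFreeIn A S D = ∀ x → x ∈ D → ∃[ y ] (y ∈ D × y ∈ S × Arc A x y)

  Disjoint : VSet n → VSet n → Set
  Disjoint D₁ D₂ = ∀ x → x ∈ D₁ → x ∈ D₂ → ⊥

-- The side C consists of the vertices that can reach D₁ along arcs of S whose
-- tails lie outside D₂.
module Separation {n} {A : Rel n} {S D₁ D₂ : VSet n}
  (S-sinkFree : SinkFreeIn A S S) (D₁-sinkFree : SinkFreeIn A S D₁) (D₂-sinkFree : SinkFreeIn A S D₂)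
  (disjoint : Disjoint D₁ D₂) where

  E : Rel n
  E x y = (A ↾ S) x y ∧ not (D₂ x)

  open Closure (closure (E ᵀ) D₁) public renaming (set to C)

  D₂∩C-empty : ∀ y → y ∈ D₂ → y ∉ C
  D₂∩C-empty y y∈D₂ with true-or-false (C y)
  ... | inj₂ y∉C = y∉C
  ... | inj₁ y∈C with reached y y∈C
  ... | x , x∈D₁ , p = ⊥-elim (avoid (reverse p) x∈D₁ y∈D₂)
    where
    avoid : ∀ {y x} → Walk E y x → x ∈ D₁ → y ∈ D₂ → ⊥
    avoid [] x∈D₁ y∈D₂ = disjoint _ x∈D₁ y∈D₂
    avoid {y} (e ∷ _) _ y∈D₂ = true≢false y∈D₂ (not-elim (∧-elimʳ {(A ↾ S) y _} e))

  first-arc : ∀ {x z} → Walk E x z → z ∈ D₁ → x ∉ D₁ → ∃[ y ] (Arc E x y × y ∈ C)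
  first-arc [] z∈D₁ z∉D₁ = ⊥-elim (true≢false z∈D₁ z∉D₁)
  first-arc (_∷_ {y = y} e p) z∈D₁ _ = y , e , reachable z∈D₁ (reverse {E = E ᵀ} p)

  friendly : FriendlyOn A S C
  friendly x x∈S with true-or-false (D₁ x) | true-or-false (D₂ x)
  ... | inj₁ x∈D₁ | _ with D₁-sinkFree x x∈D₁
  ... | y , y∈D₁ , y∈S , xy = y , y∈S , xy , trans (seed⊆ y y∈D₁) (sym (seed⊆ x x∈D₁))
  friendly x x∈S | inj₂ _ | inj₁ x∈D₂ with D₂-sinkFree x x∈D₂
  ... | y , y∈D₂ , y∈S , xy = y , y∈S , xy , trans (D₂∩C-empty y y∈D₂) (sym (D₂∩C-empty x x∈D₂))
  friendly x x∈S | inj₂ x∉D₁ | inj₂ x∉D₂ with true-or-false (C x)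
  ... | inj₁ x∈C with reached x x∈C
  ... | z , z∈D₁ , p with first-arc (reverse p) z∈D₁ x∉D₁
  ... | y , e , y∈C = y , ∧-elimʳ {A x y} (∧-elimˡ e) , ∧-elimˡ (∧-elimˡ e) , trans y∈C (sym x∈C)
  friendly x x∈S | inj₂ x∉D₁ | inj₂ x∉D₂ | inj₂ x∉C with S-sinkFree x x∈S
  ... | y , y∈S , _ , xy with true-or-false (C y)
  ... | inj₂ y∉C = y , y∈S , xy , trans y∉C (sym x∉C)
  ... | inj₁ y∈C = ⊥-elim (true≢false (closed y x y∈C (∧-intro (∧-intro xy y∈S) (not-intro x∉D₂))) x∉C)

separate-by-sinkFree : ∀ {n} {A : Rel n} {S D₁ D₂ : VSet n} → SinkFreeIn A S S →
  SinkFreeIn A S D₁ → SinkFreeIn A S D₂ → Disjoint D₁ D₂ →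
  ∀ {u v} → u ∈ D₁ → v ∈ D₂ → ∃[ side ] (FriendlyOn A S side × side u ≢ side v)
separate-by-sinkFree S-sf D₁-sf D₂-sf disjoint {u} {v} u∈D₁ v∈D₂ =
  C , friendly , λ u~v → true≢false (trans (sym u~v) (seed⊆ u u∈D₁)) (D₂∩C-empty v v∈D₂)
  where open Separation S-sf D₁-sf D₂-sf disjoint

module InductionStep {d} (1≤d : 1 ≤ d) (hyp : StronglyConnectedSeparable d)
  {n} {A : Rel n} {S : VSet n} (A-loopless : Loopless A) (deg : MinOutDegOn d A S)
  (ih : ∀ {T : VSet n} → suc (count T) ≤ count S → MinOutDegOn d A T → SeparableOn A T)
  {u v : Fin n} (u∈S : u ∈ S) (v∈S : v ∈ S) (u≢v : u ≢ v) where

  S-sinkFree : SinkFreeIn A S S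
  S-sinkFree x x∈S with count-nonempty (A x ∩ S) (≤-trans 1≤d (deg x x∈S))
  ... | y , xy∧y∈S = y , ∧-elimʳ {A x y} xy∧y∈S , ∧-elimʳ {A x y} xy∧y∈S , ∧-elimˡ xy∧y∈S

  UV : VSet n
  UV = ⁅ u ⁆ ∪ ⁅ v ⁆

  UV-cases : ∀ {x} → x ∈ UV → x ≡ u ⊎ x ≡ v
  UV-cases {x} x∈UV with ∨-elim {x ≟ᵇ u} x∈UV
  ... | inj₁ x≡u = inj₁ (≟ᵇ-sound x≡u)
  ... | inj₂ x≡v = inj₂ (≟ᵇ-sound x≡v)

  u∈UV : u ∈ UV
  u∈UV = ∨-introˡ (≟ᵇ-refl u)

  v∈UV : v ∈ UV
  v∈UV = ∨-introʳ {v ≟ᵇ u} (≟ᵇ-refl v)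

  UV⊆S : ∀ x → x ∈ UV → x ∈ S
  UV⊆S x x∈UV with UV-cases {x} x∈UV
  ... | inj₁ refl = u∈S
  ... | inj₂ refl = v∈S

  open Closure (closure (A ↾ S) UV)
    using () renaming (set to Reach; seed⊆ to UV⊆Reach; closed to Reach-closed; reached to Reach-reached)
  open Closure (closure ((A ↾ S) ᵀ) UV)
    using () renaming (set to CoReach; seed⊆ to UV⊆CoReach; closed to CoReach-closed; reached to CoReach-reached)

  Reach⊆S : ∀ x → x ∈ Reach → x ∈ S
  Reach⊆S x x∈Reach with Reach-reached x x∈Reach
  ... | y , y∈UV , p = ↾-walk-∈ p (UV⊆S y y∈UV)

  Escape : VSet n
  Escape = Reach ∖ CoReach

  Escape⊆Reach : ∀ x → x ∈ Escape → x ∈ Reach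
  Escape⊆Reach x = ∧-elimˡ

  Escape⊆S : ∀ x → x ∈ Escape → x ∈ S
  Escape⊆S x x∈Escape = Reach⊆S x (Escape⊆Reach x x∈Escape)

  CoReach∩Escape-empty : ∀ x → x ∈ CoReach → x ∉ Escape
  CoReach∩Escape-empty x x∈CoReach rewrite x∈CoReach = ∧-zeroʳ (Reach x)

  UV∩Escape-empty : ∀ x → x ∈ UV → x ∉ Escape
  UV∩Escape-empty x x∈UV = CoReach∩Escape-empty x (UV⊆CoReach x x∈UV)

  Escape-closed : ∀ x y → x ∈ Escape → Arc A x y → y ∈ S → y ∈ Escape
  Escape-closed x y x∈Escape xy y∈S with true-or-false (CoReach y)
  ... | inj₁ y∈CoReach = ⊥-elim (true≢false (CoReach-closed y x y∈CoReach (∧-intro xy y∈S))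
                                            (not-elim (∧-elimʳ {Reach x} x∈Escape)))
  ... | inj₂ y∉CoReach = ∧-intro (Reach-closed x y (∧-elimˡ x∈Escape) (∧-intro xy y∈S)) (not-intro y∉CoReach)

  Escape-minOutDeg : MinOutDegOn d A Escape
  Escape-minOutDeg x x∈Escape = ≤-trans (deg x (Escape⊆S x x∈Escape))
    (count-mono (A x ∩ S) (A x ∩ Escape) λ y xy∧y∈S →
      ∧-intro (∧-elimˡ {A x y} xy∧y∈S) (Escape-closed x y x∈Escape (∧-elimˡ {A x y} xy∧y∈S) (∧-elimʳ {A x y} xy∧y∈S)))

  Escape-separable : SeparableOn A Escape
  Escape-separable = ih (count-mono-strict Escape S Escape⊆S u (UV∩Escape-empty u u∈UV) u∈S) Escape-minOutDeg

  Escape-sinkFree : SinkFreeIn A S Escape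
  Escape-sinkFree x x∈Escape with S-sinkFree x (Escape⊆S x x∈Escape)
  ... | y , y∈S , _ , xy = y , Escape-closed x y x∈Escape xy y∈S , y∈S , xy

  -- Adding arcs from UV ∪ Escape into UV makes Reach strongly connected
  -- without creating loops or lowering out-degrees.
  Shortcut : Rel n
  Shortcut x y = (UV ∪ Escape) x ∧ UV y ∧ not (x ≟ᵇ y)

  A⁺ : Rel n
  A⁺ x y = A x y ∨ Shortcut x y

  A⁺-loopless : Loopless A⁺
  A⁺-loopless x rewrite A-loopless x | ≟ᵇ-refl x | ∧-zeroʳ (UV x) = ∧-zeroʳ ((UV ∪ Escape) x)

  A⁺-minOutDeg : MinOutDegOn d A⁺ Reach
  A⁺-minOutDeg x x∈Reach = ≤-trans (deg x (Reach⊆S x x∈Reach))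
    (count-mono (A x ∩ S) (A⁺ x ∩ Reach) λ y xy∧y∈S →
      ∧-intro (∨-introˡ (∧-elimˡ {A x y} xy∧y∈S)) (Reach-closed x y x∈Reach xy∧y∈S))

  lift : ∀ {x y} → Walk (A ↾ S) x y → x ∈ Reach → Walk (A⁺ ↾ Reach) x y
  lift [] _ = []
  lift {x} (_∷_ {y = y} e p) x∈Reach =
    ∧-intro (∨-introˡ (∧-elimˡ {A x y} e)) y∈Reach ∷ lift p y∈Reach
    where y∈Reach = Reach-closed x y x∈Reach e

  shortcut-arc : ∀ x y → x ∈ UV ∪ Escape → y ∈ UV → x ≢ y → Arc (A⁺ ↾ Reach) x y
  shortcut-arc x y x∈ y∈UV x≢y =
    ∧-intro (∨-introʳ {A x y} (∧-intro x∈ (∧-intro y∈UV (not-intro (≟ᵇ-≢ x≢y))))) (UV⊆Reach y y∈UV)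

  walk-to-UV : ∀ x → x ∈ Reach → ∃[ y ] (y ∈ UV × Walk (A⁺ ↾ Reach) x y)
  walk-to-UV x x∈Reach with true-or-false (CoReach x)
  ... | inj₁ x∈CoReach with CoReach-reached x x∈CoReach
  ... | y , y∈UV , p = y , y∈UV , lift (reverse p) x∈Reach
  walk-to-UV x x∈Reach | inj₂ x∉CoReach =
    u , u∈UV , shortcut-arc x u (∨-introʳ {UV x} x∈Escape) u∈UV x≢u ∷ []
    where
    x∈Escape : x ∈ Escape
    x∈Escape = ∧-intro x∈Reach (not-intro x∉CoReach)
    x≢u : x ≢ u
    x≢u refl = true≢false x∈Escape (UV∩Escape-empty u u∈UV)

  walk-from-UV : ∀ y → y ∈ Reach → ∃[ x ] (x ∈ UV × Walk (A⁺ ↾ Reach) x y)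
  walk-from-UV y y∈Reach with Reach-reached y y∈Reach
  ... | x , x∈UV , p = x , x∈UV , lift p (UV⊆Reach x x∈UV)

  walk-within-UV : ∀ x y → x ∈ UV → y ∈ UV → Walk (A⁺ ↾ Reach) x y
  walk-within-UV x y x∈UV y∈UV with x ≟ y
  ... | yes refl = []
  ... | no x≢y = shortcut-arc x y (∨-introˡ x∈UV) y∈UV x≢y ∷ []

  A⁺-stronglyConnected : StronglyConnectedOn A⁺ Reach
  A⁺-stronglyConnected x y x∈Reach y∈Reach with walk-to-UV x x∈Reach | walk-from-UV y y∈Reach
  ... | x′ , x′∈UV , p | y′ , y′∈UV , q = p ++ walk-within-UV x′ y′ x′∈UV y′∈UV ++ q

  abstract
    Q-partition : ∃[ Q ] (FriendlyOn A⁺ Reach Q × Q u ≢ Q v)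
    Q-partition = separableOn-stronglyConnected hyp A⁺-loopless A⁺-minOutDeg A⁺-stronglyConnected
      u v (UV⊆Reach u u∈UV) (UV⊆Reach v v∈UV) u≢v

  Q : VSet n
  Q = proj₁ Q-partition

  Q-friendly : FriendlyOn A⁺ Reach Q
  Q-friendly = proj₁ (proj₂ Q-partition)

  Q-separates : Q u ≢ Q v
  Q-separates = proj₂ (proj₂ Q-partition)

  Q-injective-on-UV : ∀ {x y} → x ∈ UV → y ∈ UV → Q x ≡ Q y → x ≡ y
  Q-injective-on-UV {x} {y} x∈UV y∈UV Qx≡Qy with UV-cases {x} x∈UV | UV-cases {y} y∈UV
  ... | inj₁ refl | inj₁ refl = refl
  ... | inj₁ refl | inj₂ refl = ⊥-elim (Q-separates Qx≡Qy)
  ... | inj₂ refl | inj₁ refl = ⊥-elim (Q-separates (sym Qx≡Qy))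
  ... | inj₂ refl | inj₂ refl = refl

  -- A chosen Q-friend of each vertex of Reach (junk value x outside Reach).
  private
    friend-or-self : ∀ x b → Reach x ≡ b → Fin n
    friend-or-self x true x∈Reach = proj₁ (Q-friendly x x∈Reach)
    friend-or-self x false _ = x

  next : Fin n → Fin n
  next x = friend-or-self x (Reach x) refl

  next-spec : ∀ x → x ∈ Reach → next x ∈ Reach × Arc A⁺ x (next x) × Q (next x) ≡ Q x
  next-spec x = go (Reach x) refl
    where
    go : ∀ b (eq : Reach x ≡ b) → b ≡ true →
      let y = friend-or-self x b eq in y ∈ Reach × Arc A⁺ x y × Q y ≡ Q x
    go true x∈Reach _ = proj₂ (Q-friendly x x∈Reach)

  -- Outside Escape the only shortcuts join u and v, which Q separates.
  next-arc : ∀ x → x ∈ Reach → x ∉ Escape → Arc A x (next x)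
  next-arc x x∈Reach x∉Escape with next-spec x x∈Reach
  ... | _ , x→next , same-side with ∨-elim {A x (next x)} x→next
  ... | inj₁ arc = arc
  ... | inj₂ shortcut = ⊥-elim (true≢false x≡next (not-elim (∧-elimʳ {UV (next x)} (∧-elimʳ {(UV ∪ Escape) x} shortcut))))
    where
    x∈UV : x ∈ UV
    x∈UV with ∨-elim {UV x} (∧-elimˡ shortcut)
    ... | inj₁ x∈UV = x∈UV
    ... | inj₂ x∈Escape = ⊥-elim (true≢false x∈Escape x∉Escape)
    x≡next : x ≟ᵇ next x ≡ true
    x≡next = subst (λ y → x ≟ᵇ y ≡ true)
      (Q-injective-on-UV x∈UV (∧-elimˡ (∧-elimʳ {(UV ∪ Escape) x} shortcut)) (sym same-side)) (≟ᵇ-refl x)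

  -- The orbit of x under next, stopped on entering Escape.
  Follow : Rel n
  Follow x y = (y ≟ᵇ next x) ∧ (Reach ∖ Escape) x

  module Orbit (x : Fin n) = Closure (closure Follow ⁅ x ⁆)

  orbit : Fin n → VSet n
  orbit x = Orbit.set x

  x∈orbit : ∀ x → x ∈ orbit x
  x∈orbit x = Orbit.seed⊆ x x (≟ᵇ-refl x)

  follow-arc : ∀ x y → Arc Follow x y → y ≡ next x × x ∈ Reach × x ∉ Escape
  follow-arc x y e = ≟ᵇ-sound {x = y} (∧-elimˡ e) , ∧-elimˡ (∧-elimʳ {y ≟ᵇ next x} e) ,
                     not-elim (∧-elimʳ {Reach x} (∧-elimʳ {y ≟ᵇ next x} e))

  follow-walk-side : ∀ {x y} → Walk Follow x y → x ∈ Reach → y ∈ Reach × Q y ≡ Q x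
  follow-walk-side [] x∈Reach = x∈Reach , refl
  follow-walk-side {x} (_∷_ {y = y} e p) x∈Reach with follow-arc x y e
  ... | refl , _ with next-spec x x∈Reach
  ... | next∈Reach , _ , same-side with follow-walk-side p next∈Reach
  ... | y∈Reach , Qy≡Qnext = y∈Reach , trans Qy≡Qnext same-side

  orbit-side : ∀ x y → x ∈ Reach → y ∈ orbit x → y ∈ Reach × Q y ≡ Q x
  orbit-side x y x∈Reach y∈orbit with Orbit.reached x y y∈orbit
  ... | x′ , x′≡x , p with ≟ᵇ-sound {x = x′} {y = x} x′≡x
  ... | refl = follow-walk-side p x∈Reach

  orbit-next : ∀ x y → x ∈ Reach → y ∈ orbit x → y ∉ Escape → next y ∈ orbit x
  orbit-next x y x∈Reach y∈orbit y∉Escape = Orbit.closed x y (next y) y∈orbit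
    (∧-intro (≟ᵇ-refl (next y)) (∧-intro (proj₁ (orbit-side x y x∈Reach y∈orbit)) (not-intro y∉Escape)))

  follow-walks-exit-unique : ∀ {x y y′} → Walk Follow x y → Walk Follow x y′ → y ∈ Escape → y′ ∈ Escape → y ≡ y′
  follow-walks-exit-unique [] [] _ _ = refl
  follow-walks-exit-unique {x} [] (_∷_ {y = z} e _) x∈Escape _ =
    ⊥-elim (true≢false x∈Escape (proj₂ (proj₂ (follow-arc x z e))))
  follow-walks-exit-unique {x} (_∷_ {y = z} e _) [] _ x∈Escape =
    ⊥-elim (true≢false x∈Escape (proj₂ (proj₂ (follow-arc x z e))))
  follow-walks-exit-unique {x} (_∷_ {y = z} e p) (_∷_ {y = z′} e′ p′) y∈Escape y′∈Escape
    with follow-arc x z e | follow-arc x z′ e′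
  ... | refl , _ | refl , _ = follow-walks-exit-unique p p′ y∈Escape y′∈Escape

  orbit-exit-unique : ∀ x y y′ → y ∈ orbit x ∩ Escape → y′ ∈ orbit x ∩ Escape → y ≡ y′
  orbit-exit-unique x y y′ y∈ y′∈ with Orbit.reached x y (∧-elimˡ y∈) | Orbit.reached x y′ (∧-elimˡ y′∈)
  ... | x₁ , x₁≡x , p | x₂ , x₂≡x , p′ with ≟ᵇ-sound {x = x₁} {y = x} x₁≡x | ≟ᵇ-sound {x = x₂} {y = x} x₂≡x
  ... | refl | refl = follow-walks-exit-unique p p′ (∧-elimʳ {orbit x y} y∈) (∧-elimʳ {orbit x y′} y′∈)

  Around : Fin n → VSet n → VSet n
  Around x ρ = (orbit x ∖ Escape) ∪ ρ

  Around-sinkFree : ∀ x ρ → x ∈ Reach → SinkFreeIn A S ρ →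
    (∀ y → y ∈ orbit x ∩ Escape → y ∈ ρ) → SinkFreeIn A S (Around x ρ)
  Around-sinkFree x ρ x∈Reach ρ-sinkFree exits⊆ρ y y∈ with ∨-elim {(orbit x ∖ Escape) y} y∈
  ... | inj₂ y∈ρ with ρ-sinkFree y y∈ρ
  ... | z , z∈ρ , z∈S , yz = z , ∨-introʳ {(orbit x ∖ Escape) z} z∈ρ , z∈S , yz
  Around-sinkFree x ρ x∈Reach ρ-sinkFree exits⊆ρ y y∈ | inj₁ y∈orbit∖Escape =
    next y , next∈Around , Reach⊆S (next y) next∈Reach , next-arc y y∈Reach y∉Escape
    where
    y∈orbit = ∧-elimˡ y∈orbit∖Escape
    y∉Escape = not-elim (∧-elimʳ {orbit x y} y∈orbit∖Escape)
    y∈Reach = proj₁ (orbit-side x y x∈Reach y∈orbit)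
    next∈Reach = proj₁ (next-spec y y∈Reach)
    next∈orbit = orbit-next x y x∈Reach y∈orbit y∉Escape
    next∈Around : next y ∈ Around x ρ
    next∈Around with true-or-false (Escape (next y))
    ... | inj₁ next∈Escape = ∨-introʳ {(orbit x ∖ Escape) (next y)} (exits⊆ρ (next y) (∧-intro next∈orbit next∈Escape))
    ... | inj₂ next∉Escape = ∨-introˡ (∧-intro next∈orbit (not-intro next∉Escape))

  u∈Reach : u ∈ Reach
  u∈Reach = UV⊆Reach u u∈UV

  v∈Reach : v ∈ Reach
  v∈Reach = UV⊆Reach v v∈UV

  orbits-disjoint : ∀ y → y ∈ orbit u → y ∈ orbit v → ⊥
  orbits-disjoint y y∈orbit-u y∈orbit-v = Q-separates (trans
    (sym (proj₂ (orbit-side u y u∈Reach y∈orbit-u))) (proj₂ (orbit-side v y v∈Reach y∈orbit-v)))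

  separate-with-exits : (ρu ρv : VSet n) → (∀ y → y ∈ ρu → y ∈ Escape) → (∀ y → y ∈ ρv → y ∈ Escape) →
    SinkFreeIn A S ρu → SinkFreeIn A S ρv → Disjoint ρu ρv →
    (∀ y → y ∈ orbit u ∩ Escape → y ∈ ρu) → (∀ y → y ∈ orbit v ∩ Escape → y ∈ ρv) →
    ∃[ side ] (FriendlyOn A S side × side u ≢ side v)
  separate-with-exits ρu ρv ρu⊆Escape ρv⊆Escape ρu-sf ρv-sf ρu∩ρv exits-u exits-v =
    separate-by-sinkFree S-sinkFree (Around-sinkFree u ρu u∈Reach ρu-sf exits-u)
      (Around-sinkFree v ρv v∈Reach ρv-sf exits-v) disjoint (start {ρu} u u∈UV) (start {ρv} v v∈UV)
    where
    start : ∀ {ρ} x → x ∈ UV → x ∈ Around x ρ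
    start x x∈UV = ∨-introˡ (∧-intro (x∈orbit x) (not-intro (UV∩Escape-empty x x∈UV)))
    disjoint : Disjoint (Around u ρu) (Around v ρv)
    disjoint y y∈u y∈v with ∨-elim {(orbit u ∖ Escape) y} y∈u | ∨-elim {(orbit v ∖ Escape) y} y∈v
    ... | inj₁ y∈orbit-u | inj₁ y∈orbit-v = orbits-disjoint y (∧-elimˡ y∈orbit-u) (∧-elimˡ y∈orbit-v)
    ... | inj₁ y∈orbit-u | inj₂ y∈ρv =
      true≢false (ρv⊆Escape y y∈ρv) (not-elim (∧-elimʳ {orbit u y} y∈orbit-u))
    ... | inj₂ y∈ρu | inj₁ y∈orbit-v =
      true≢false (ρu⊆Escape y y∈ρu) (not-elim (∧-elimʳ {orbit v y} y∈orbit-v))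
    ... | inj₂ y∈ρu | inj₂ y∈ρv = ρu∩ρv y y∈ρu y∈ρv

  SideClass : VSet n → Fin n → VSet n
  SideClass P y w = does (P w ≟B P y)

  separate-both-exits : ∀ yu yv → yu ∈ orbit u ∩ Escape → yv ∈ orbit v ∩ Escape →
    ∃[ side ] (FriendlyOn A S side × side u ≢ side v)
  separate-both-exits yu yv yu-exit yv-exit with Escape-separable yu yv
      (∧-elimʳ {orbit u yu} yu-exit) (∧-elimʳ {orbit v yv} yv-exit) yu≢yv
    where
    yu≢yv : yu ≢ yv
    yu≢yv refl = orbits-disjoint yu (∧-elimˡ yu-exit) (∧-elimˡ yv-exit)
  ... | P , P-friendly , P-separates =
    separate-with-exits (Escape ∩ SideClass P yu) (Escape ∩ SideClass P yv) (λ _ → ∧-elimˡ) (λ _ → ∧-elimˡ)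
      (class-sinkFree yu) (class-sinkFree yv) classes-disjoint (exit-in-class u yu yu-exit) (exit-in-class v yv yv-exit)
    where
    class-sinkFree : ∀ y → SinkFreeIn A S (Escape ∩ SideClass P y)
    class-sinkFree y x x∈ with P-friendly x (∧-elimˡ x∈)
    ... | z , z∈Escape , xz , Pz≡Px = z ,
      ∧-intro z∈Escape (dec-true (P z ≟B P y) (trans Pz≡Px (does-sound (P x ≟B P y) (∧-elimʳ {Escape x} x∈)))) ,
      Escape⊆S z z∈Escape , xz
    classes-disjoint : Disjoint (Escape ∩ SideClass P yu) (Escape ∩ SideClass P yv)
    classes-disjoint w w∈u w∈v = P-separates (trans
      (sym (does-sound (P w ≟B P yu) (∧-elimʳ {Escape w} w∈u))) (does-sound (P w ≟B P yv) (∧-elimʳ {Escape w} w∈v)))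
    exit-in-class : ∀ x y → y ∈ orbit x ∩ Escape → ∀ z → z ∈ orbit x ∩ Escape → z ∈ Escape ∩ SideClass P y
    exit-in-class x y y-exit z z-exit = ∧-intro (∧-elimʳ {orbit x z} z-exit)
      (dec-true (P z ≟B P y) (cong P (orbit-exit-unique x z y z-exit y-exit)))

  no-exit : ∀ x → anyᵇ (orbit x ∩ Escape) ≡ false → ∀ y → y ∈ orbit x ∩ Escape → y ∈ ∅
  no-exit x none y y-exit = ⊥-elim (true≢false y-exit (anyᵇ-false (orbit x ∩ Escape) none y))

  separation : ∃[ side ] (FriendlyOn A S side × side u ≢ side v)
  separation with anyᵇ (orbit v ∩ Escape) in exit-v
  ... | false = separate-with-exits Escape ∅ (λ _ y∈ → y∈) (λ _ ()) Escape-sinkFree (λ _ ()) (λ _ _ ())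
                  (λ y y-exit → ∧-elimʳ {orbit u y} y-exit) (no-exit v exit-v)
  ... | true with anyᵇ (orbit u ∩ Escape) in exit-u
  ... | false = separate-with-exits ∅ Escape (λ _ ()) (λ _ y∈ → y∈) (λ _ ()) Escape-sinkFree (λ _ ())
                  (no-exit u exit-u) (λ y y-exit → ∧-elimʳ {orbit v y} y-exit)
  ... | true with anyᵇ-elim _ exit-u | anyᵇ-elim _ exit-v
  ... | yu , yu-exit | yv , yv-exit = separate-both-exits yu yv yu-exit yv-exit

separableOn-bounded : ∀ {d} → 1 ≤ d → StronglyConnectedSeparable d →
  ∀ k {n} {A : Rel n} {S : VSet n} → count S ≤ k → Loopless A → MinOutDegOn d A S → SeparableOn A S
separableOn-bounded _ _ zero {S = S} ∣S∣≤0 _ _ u _ u∈S _ _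
  with ≤-trans (count-mono-strict ∅ S (λ _ ()) u refl u∈S) ∣S∣≤0
... | ()
separableOn-bounded {d} 1≤d hyp (suc k) {A = A} {S} ∣S∣≤1+k A-loopless deg u v u∈S v∈S u≢v =
  InductionStep.separation 1≤d hyp A-loopless deg ih u∈S v∈S u≢v
  where
  ih : ∀ {T} → suc (count T) ≤ count S → MinOutDegOn d A T → SeparableOn A T
  ih ∣T∣<∣S∣ = separableOn-bounded 1≤d hyp k (≤-pred (≤-trans ∣T∣<∣S∣ ∣S∣≤1+k)) A-loopless

separableOn : ∀ {d} → 1 ≤ d → StronglyConnectedSeparable d →
  ∀ {n} {A : Rel n} {S : VSet n} → Loopless A → MinOutDegOn d A S → SeparableOn A S
separableOn 1≤d hyp {S = S} = separableOn-bounded 1≤d hyp _ (count≤n S)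

module _ {n} (G : Digraph n) where

  V : VSet n
  V _ = true

  minOutDegOn-V : ∀ {d} → MinOutDegAtLeast d G → MinOutDegOn d (adj G) V
  minOutDegOn-V deg x _ = ≤-trans (deg x) (≤-trans (≤-reflexive (length-filter-tabulate (λ i → i) (adj G x)))
    (count-mono (adj G x) (adj G x ∩ V) λ _ xy → ∧-intro xy refl))

  friendlyPartition : ∀ {side u v} → FriendlyOn (adj G) V side → side u ≢ side v → FriendlyPartition G side
  friendlyPartition {side} {u} {v} friendly u≁v = proj₁ sides , proj₂ sides ,
    λ x → let y , _ , xy , same = friendly x refl in y , xy , same
    where
    parts : side u ≡ true ⊎ side u ≡ false → side v ≡ true ⊎ side v ≡ false →
      (∃[ a ] side a ≡ true) × (∃[ b ] side b ≡ false)
    parts (inj₁ u∈) (inj₂ v∉) = (u , u∈) , (v , v∉)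
    parts (inj₂ u∉) (inj₁ v∈) = (v , v∈) , (u , u∉)
    parts (inj₁ u∈) (inj₁ v∈) = ⊥-elim (u≁v (trans u∈ (sym v∈)))
    parts (inj₂ u∉) (inj₂ v∉) = ⊥-elim (u≁v (trans u∉ (sym v∉)))
    sides = parts (true-or-false (side u)) (true-or-false (side v))

-- The proof uses only 1 ≤ d.
proposition1p5 : (d : ℕ) → 3 ≤ d →
    (∀ (n : ℕ) (G : Digraph n) → StronglyConnected G → MinOutDegAtLeast d G → AllPairsSeparable G) →
    ∀ (n : ℕ) (G : Digraph n) → MinOutDegAtLeast d G → AllPairsSeparable G
proposition1p5 d 3≤d hyp n G deg u v u≢v
  with separableOn (≤-trans (s≤s z≤n) 3≤d) hyp (loopless G) (minOutDegOn-V G deg) u v refl refl u≢v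
... | side , friendly , u≁v = side , friendlyPartition G friendly u≁v , u≁v
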